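{- Let $\mathcal S$ be one of the seven Weyl models, with group $G$ of order $2d$, and $\omega$ the unique element of length $d$ in $G$. With $A(x,y)$ and $P_g(x,y)$ as defined in the context, \[ \sum_{g\in G\setminus\{\omega\}}\varepsilon_g\,P_g(x,y)=0. \]
   Context: Weyl models (step sets): simple $\{(1,0),(0,1),(-1,0),(0,-1)\}$; diagonal $\{(1,1),(-1,1),(-1,-1),(1,-1)\}$; king $\{ -1,0,1\}^2\setminus\{(0,0)\}$; diabolo $\{(1,0),(1,1),(-1,1),(-1,0),(-1,-1),(1,-1)\}$; tandem $\{(1,0),(-1,1),(0,-1)\}$; double tandem $\{(1,0),(-1,1),(0,-1),(-1,0),(1,-1),(0,1)\}$; Gouyou-Beauchamps $\{(1,0),(-1,0),(-1,1),(1,-1)\}$. Write $\sum_{(i,j)\in\mathcal S}x^iy^j=\bar yH_-(x)+H_0(x)+yH_+(x)=\bar xV_-(y)+V_0(y)+xV_+(y)$ with $\bar x=1/x$, $\bar y=1/y$. The group $G$ is generated by the involutions $\phi(u,v)=(\bar uV_-(v)/V_+(v),v)$ and $\psi(u,v)=(u,\bar vH_-(u)/H_+(u))$; it is finite of order $2d$, $d\in\{2,3,4\}$, and each $g(x,y)$ is a pair of Laurent monomials. $\ell(g)$ is the least number of generators in a product equal to $g$, $\varepsilon_g=(-1)^{\ell(g)}$, and $\omega=\phi\psi\phi\cdots$ ($d$ alternating generators) is the unique element of length $d$. $G$ acts on series by $g(F(x,y))=F(g(x,y))$, and on points of $\mathbb Z^2$ by $\dot g(a,b)=(c,d')$ where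 $x^cy^{d'}=\bar x\bar y\,g(x^{a+1}y^{b+1})$. $\mathcal Q=\{(i,j):i,j\ge0\}$, $\mathcal C=\{(i,j)\in\mathbb Z^2:i\ge0\text{ or }j\ge0\}$. A walk is confined to $\mathcal C$ if all its vertices lie in $\mathcal C$ and it uses no step between $(-1,0)$ and $(0,-1)$. $C(x,y)=\sum x^iy^jt^n$ over walks from $(0,0)$ confined to $\mathcal C$ ($(i,j)$ the endpoint, $n$ the length), and $Q(x,y)$ likewise for walks from $(0,0)$ with all vertices in $\mathcal Q$. Define $A(x,y)=C(x,y)-\frac{\bar x\bar y}{2d-1}\sum_{h\in G\setminus\{\omega\}}\varepsilon_h\,h\big(xyQ(x,y)\big)$, with coefficients $A_{k,l}$ (coefficient of $x^ky^l$), and for $g\in G$ let $P_g(x,y)=\sum_{(i,j)\in\mathcal Q}A_{\dot g(i,j)}x^iy^j\in\mathbb Q[x,y][[t]]$, so that $\bar x\bar y\,g(xy)\,P_g(g(x,y))$ is the part of $A(x,y)$ supported on $\dot g(\mathcal Q)$. -}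

module Defs where

open import Data.Bool using (Bool; true; false; _∧_; _∨_; not)
open import Data.Nat as ℕ using (ℕ; zero; suc)
open import Data.Integer as ℤ using (ℤ; +_; -[1+_]; 0ℤ)
open import Data.Integer.Properties as ℤP using ()
open import Data.Rational as ℚ using (ℚ; 0ℚ; 1ℚ)
open import Data.Product using (_×_; _,_; proj₁; proj₂)
open import Data.List using (List; []; _∷_; map; concatMap; length; filterᵇ; foldr)
open import Relation.Nullary using (does)
open import Relation.Binary.PropositionalEquality using (_≡_; refl)

-- Points of ℤ², monomials x^a y^b are identified with exponent pairs.

Pt : Set
Pt = ℤ × ℤ

_⊕_ : Pt → Pt → Pt
(a , b) ⊕ (c , d) = (a ℤ.+ c , b ℤ.+ d)

_⊛_ : ℤ → Pt → Pt
k ⊛ (a , b) = (k ℤ.* a , k ℤ.* b)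

⊖_ : Pt → Pt
⊖ (a , b) = (ℤ.- a , ℤ.- b)

_==ℤ_ : ℤ → ℤ → Bool
a ==ℤ b = does (a ℤP.≟ b)

_==_ : Pt → Pt → Bool
(a , b) == (c , d) = (a ==ℤ c) ∧ (b ==ℤ d)

data Model : Set where
  simple diagonal king diabolo tandem doubleTandem gouyouBeauchamps : Model

-1ℤ : ℤ
-1ℤ = -[1+ 0 ]

1ℤ : ℤ
1ℤ = + 1

steps : Model → List Pt
steps simple   = (1ℤ , 0ℤ) ∷ (0ℤ , 1ℤ) ∷ (-1ℤ , 0ℤ) ∷ (0ℤ , -1ℤ) ∷ []
steps diagonal = (1ℤ , 1ℤ) ∷ (-1ℤ , 1ℤ) ∷ (-1ℤ , -1ℤ) ∷ (1ℤ , -1ℤ) ∷ []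
steps king     = (1ℤ , 0ℤ) ∷ (1ℤ , 1ℤ) ∷ (0ℤ , 1ℤ) ∷ (-1ℤ , 1ℤ)
               ∷ (-1ℤ , 0ℤ) ∷ (-1ℤ , -1ℤ) ∷ (0ℤ , -1ℤ) ∷ (1ℤ , -1ℤ) ∷ []
steps diabolo  = (1ℤ , 0ℤ) ∷ (1ℤ , 1ℤ) ∷ (-1ℤ , 1ℤ) ∷ (-1ℤ , 0ℤ)
               ∷ (-1ℤ , -1ℤ) ∷ (1ℤ , -1ℤ) ∷ []
steps tandem   = (1ℤ , 0ℤ) ∷ (-1ℤ , 1ℤ) ∷ (0ℤ , -1ℤ) ∷ []
steps doubleTandem = (1ℤ , 0ℤ) ∷ (-1ℤ , 1ℤ) ∷ (0ℤ , -1ℤ)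
                   ∷ (-1ℤ , 0ℤ) ∷ (1ℤ , -1ℤ) ∷ (0ℤ , 1ℤ) ∷ []
steps gouyouBeauchamps = (1ℤ , 0ℤ) ∷ (-1ℤ , 0ℤ) ∷ (-1ℤ , 1ℤ) ∷ (1ℤ , -1ℤ) ∷ []

half : Model → ℕ
half simple = 2
half diagonal = 2
half king = 2
half diabolo = 2
half tandem = 3
half doubleTandem = 3
half gouyouBeauchamps = 4

-- For every Weyl model, V₋(v)/V₊(v) = v^(kφ m) and
-- H₋(u)/H₊(u) = u^(kψ m) are monomials (checked below in 'ratio-check'),
-- so  φ(u,v) = (ū v^(kφ m), v)  and  ψ(u,v) = (u, v̄ u^(kψ m)).

kφ : Model → ℤ
kφ tandem = 1ℤ
kφ doubleTandem = 1ℤ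
kφ gouyouBeauchamps = 1ℤ
kφ _ = 0ℤ

kψ : Model → ℤ
kψ tandem = 1ℤ
kψ doubleTandem = 1ℤ
kψ gouyouBeauchamps = + 2
kψ _ = 0ℤ

-- Multiplicity of the monomial z^e in the Laurent polynomial V₋ (resp. V₊,H₋,H₊).
countᵇ : {A : Set} → (A → Bool) → List A → ℕ
countᵇ p xs = length (filterᵇ p xs)

Vm Vp Hm Hp : Model → ℤ → ℕ
Vm m e = countᵇ (λ s → s == (-1ℤ , e)) (steps m)
Vp m e = countᵇ (λ s → s == (1ℤ , e)) (steps m)
Hm m e = countᵇ (λ s → s == (e , -1ℤ)) (steps m)
Hp m e = countᵇ (λ s → s == (e , 1ℤ)) (steps m)

-- Sanity check: V₋(v) = v^(kφ) V₊(v) and H₋(u) = u^(kψ) H₊(u)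
-- (exponents of the step sets lie in {-1,0,1}, so testing e ∈ {-3..3} suffices).
range : List ℤ
range = -[1+ 2 ] ∷ -[1+ 1 ] ∷ -1ℤ ∷ 0ℤ ∷ 1ℤ ∷ + 2 ∷ + 3 ∷ []

allᵇ : {A : Set} → (A → Bool) → List A → Bool
allᵇ p = foldr (λ a r → p a ∧ r) true

ratioOK : Model → Bool
ratioOK m = allᵇ (λ e → (Vm m (e ℤ.+ kφ m) ℕ.≡ᵇ Vp m e)
                      ∧ (Hm m (e ℤ.+ kψ m) ℕ.≡ᵇ Hp m e)) range

ratio-check : ∀ m → ratioOK m ≡ true
ratio-check simple = refl
ratio-check diagonal = refl
ratio-check king = refl
ratio-check diabolo = refl
ratio-check tandem = refl
ratio-check doubleTandem = refl
ratio-check gouyouBeauchamps = refl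

-- Group elements as pairs of Laurent monomials (U , V) = g(x,y),
-- each monomial given by its exponent vector.

Subst : Set
Subst = Pt × Pt

idS : Subst
idS = ((1ℤ , 0ℤ) , (0ℤ , 1ℤ))

φ-at : Model → Subst → Subst
φ-at m (U , V) = ((⊖ U) ⊕ (kφ m ⊛ V) , V)

ψ-at : Model → Subst → Subst
ψ-at m (U , V) = (U , (⊖ V) ⊕ (kψ m ⊛ U))

data Gen : Set where
  φ ψ : Gen

other : Gen → Gen
other φ = ψ
other ψ = φ

alt : Gen → ℕ → List Gen
alt g zero = []
alt g (suc n) = g ∷ alt (other g) n

gen-at : Model → Gen → Subst → Subst
gen-at m φ = φ-at m
gen-at m ψ = ψ-at m

evalWord : Model → List Gen → Subst
evalWord m = foldr (gen-at m) idS

-- Elements of G ∖ {ω} together with their length: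
-- the identity, and for 1 ≤ k ≤ d-1 the two alternating words of length k.
record Elem : Set where
  constructor elem
  field
    word : List Gen
    len  : ℕ

nonOmegaFrom : ℕ → ℕ → List Elem
nonOmegaFrom k zero = []
nonOmegaFrom k (suc r) = elem (alt φ k) k ∷ elem (alt ψ k) k ∷ nonOmegaFrom (suc k) r

nonOmega : Model → List Elem
nonOmega m = elem [] 0 ∷ nonOmegaFrom 1 (half m ℕ.∸ 1)

-- Sanity check: the two alternating words of length d agree (this is ω),
-- so the list above, with ω, enumerates the dihedral group of order 2d.
omega-check : ∀ m → evalWord m (alt φ (half m)) ≡ evalWord m (alt ψ (half m))
omega-check simple = refl
omega-check diagonal = refl
omega-check king = refl
omega-check diabolo = refl
omega-check tandem = refl
omega-check doubleTandem = refl
omega-check gouyouBeauchamps = refl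

sgn : ℕ → ℚ
sgn zero = 1ℚ
sgn (suc n) = ℚ.- sgn n

applyMono : Subst → Pt → Pt
applyMono (U , V) (a , b) = (a ⊛ U) ⊕ (b ⊛ V)

-- ġ(a,b) : x^c y^d' = x̄ ȳ g(x^(a+1) y^(b+1))
dot : Subst → Pt → Pt
dot g (a , b) = applyMono g (a ℤ.+ 1ℤ , b ℤ.+ 1ℤ) ⊕ (-1ℤ , -1ℤ)

-- Walks.  A walk of length n is a list of n steps starting at (0,0).

walks : Model → ℕ → List (List Pt)
walks m zero = [] ∷ []
walks m (suc n) = concatMap (λ s → map (s ∷_) (walks m n)) (steps m)

vertices : Pt → List Pt → List Pt
vertices p [] = p ∷ []
vertices p (s ∷ w) = p ∷ vertices (p ⊕ s) w

endpoint : Pt → List Pt → Pt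
endpoint p [] = p
endpoint p (s ∷ w) = endpoint (p ⊕ s) w

origin : Pt
origin = (0ℤ , 0ℤ)

inQuadrant : Pt → Bool
inQuadrant (a , b) = (0ℤ ℤ.≤ᵇ a) ∧ (0ℤ ℤ.≤ᵇ b)

inCone : Pt → Bool
inCone (a , b) = (0ℤ ℤ.≤ᵇ a) ∨ (0ℤ ℤ.≤ᵇ b)

forbiddenStep : Pt → Pt → Bool
forbiddenStep p q = ((p == (-1ℤ , 0ℤ)) ∧ (q == (0ℤ , -1ℤ)))
                  ∨ ((p == (0ℤ , -1ℤ)) ∧ (q == (-1ℤ , 0ℤ)))

noForbidden : List Pt → Bool
noForbidden [] = true
noForbidden (p ∷ []) = true
noForbidden (p ∷ q ∷ vs) = not (forbiddenStep p q) ∧ noForbidden (q ∷ vs)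

quadrantWalk : List Pt → Bool
quadrantWalk w = allᵇ inQuadrant (vertices origin w)

coneWalk : List Pt → Bool
coneWalk w = allᵇ inCone (vertices origin w) ∧ noForbidden (vertices origin w)

ℕtoℚ : ℕ → ℚ
ℕtoℚ n = + n ℚ./ 1

-- [x^k y^l t^n] C(x,y)
coefC : Model → ℕ → Pt → ℚ
coefC m n p = ℕtoℚ (countᵇ (λ w → coneWalk w ∧ (endpoint origin w == p)) (walks m n))

-- [x^k y^l t^n] x̄ȳ h(xy Q(x,y))  =  Σ over quadrant walks w of length n
-- of [x^k y^l] x̄ȳ h(x^(i+1) y^(j+1)),  (i,j) = endpoint of w
coefHQ : Model → ℕ → Subst → Pt → ℚ
coefHQ m n h p =
  ℕtoℚ (countᵇ (λ w → quadrantWalk w ∧ (dot h (endpoint origin w) == p)) (walks m n))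

sumℚ : List ℚ → ℚ
sumℚ = foldr ℚ._+_ 0ℚ

invDen : Model → ℚ
invDen m = + 1 ℚ./ suc (2 ℕ.* (half m ℕ.∸ 1))

-- [x^k y^l t^n] A(x,y) = [t^n] A_{k,l}
coefA : Model → ℕ → Pt → ℚ
coefA m n p = coefC m n p ℚ.- invDen m ℚ.*
  sumℚ (map (λ h → sgn (Elem.len h) ℚ.* coefHQ m n (evalWord m (Elem.word h)) p) (nonOmega m))

-- [x^i y^j t^n] P_g(x,y) = [t^n] A_{ġ(i,j)}   for (i,j) ∈ 𝒬
coefP : Model → Subst → ℕ → ℕ → ℕ → ℚ
coefP m g n i j = coefA m n (dot g (+ i , + j))

-- [x^i y^j t^n] Σ_{g ∈ G∖{ω}} ε_g P_g(x,y)
coefSumP : Model → ℕ → ℕ → ℕ → ℚ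
coefSumP m n i j =
  sumℚ (map (λ g → sgn (Elem.len g) ℚ.* coefP m (evalWord m (Elem.word g)) n i j) (nonOmega m))

module Submission where

-- Write ġ for the action on points, C_n(q) and Q_n(q) for the numbers of length-n cone and
-- quadrant walks ending at q, and T_n(p) = Σ_{g ≠ ω} ε_g C_n(ġ p).  On the quadrant T_n = Q_n:
-- each g ≠ ω maps 𝒬 into the cone, away from the ends (-1,0) and (0,-1) of the forbidden step,
-- and permutes the step set, so T_n obeys the last-step recurrence of Q_n at quadrant points;
-- on the lines x = -1 and y = -1 the terms of T_n cancel in pairs with opposite signs, except
-- for terms evaluated at points of negative coordinates, where C_n vanishes; and at n = 0 only
-- the identity sends a quadrant point to the origin.
-- For distinct g, h the images ġ(𝒬) and ḣ(𝒬) are disjoint (a linear functional separates them)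
-- and each ġ is injective, so only h = g contributes to the correction term of A on ġ(𝒬), with
-- weight ε_g Q_n.  Hence Σ_g ε_g P_g = T_n − (2d−1)/(2d−1) · Q_n = 0.  The facts about the
-- individual models are finite computations over the group and the step set.

open import Defs
open import Algebra.Bundles using (CommutativeMonoid; CommutativeSemiring; CommutativeRing)
open import Algebra.Core using (Op₂)
open import Algebra.Structures using (IsCommutativeSemiring)
open import Data.Bool using (Bool; true; false; _∧_; _∨_; not; if_then_else_; T)
open import Data.Bool.ListAction using (any)
open import Data.Bool.Properties using (T-∧; T-∨; T-≡; ∧-assoc; ∧-comm; ∧-identityʳ; ∧-zeroʳ; ∧-commutativeMonoid)
open import Data.Integer as ℤ using (ℤ; +_; -[1+_]; 0ℤ)
import Data.Integer.Properties as ℤP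
open import Data.List using (List; []; _∷_; null; length; cartesianProduct; map; concatMap; foldr; _++_; _∷ʳ_)
open import Data.List.Membership.Propositional using (_∈_)
open import Data.List.Properties using (map-∘)
open import Data.List.Relation.Unary.Any using (here; there; satisfied)
open import Data.List.Relation.Unary.Any.Properties using (any⁻)
open import Data.Maybe as Maybe using (Maybe; just; nothing)
open import Data.Nat as ℕ using (ℕ; zero; suc)
import Data.Nat.Properties as ℕP
open import Data.Product using (_×_; _,_; proj₁; proj₂; Σ-syntax; uncurry)
open import Data.Product.Properties using (≡-dec)
open import Data.Rational as ℚ using (ℚ; 0ℚ; 1ℚ)
import Data.Rational.Properties as ℚP
import Data.Rational.Unnormalised as ℚᵘ
import Data.Rational.Unnormalised.Properties as ℚᵘP
open import Data.Sum as Sum using (_⊎_; inj₁; inj₂)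
open import Function using (_∘_; Equivalence)
open import Level using (0ℓ)
open import Relation.Binary.Definitions using (DecidableEquality)
open import Relation.Binary.PropositionalEquality
open import Relation.Nullary using (¬_; Dec; does; yes; no)
open import Relation.Nullary.Decidable using (map′; _×-dec_; dec-true; dec-false)

private variable A B : Set

infix 4 _≟ᴾ_

_≟ᴾ_ : DecidableEquality Pt
(a , b) ≟ᴾ (c , d) =
  map′ (uncurry (cong₂ _,_)) (λ e → cong proj₁ e , cong proj₂ e) ((a ℤP.≟ c) ×-dec (b ℤP.≟ d))

==-does : (p q : Pt) → (p == q) ≡ does (p ≟ᴾ q)
==-does (a , b) (c , d) = refl

≢⇒== : {p q : Pt} → ¬ p ≡ q → (p == q) ≡ false
≢⇒== {p} {q} p≢q = trans (==-does p q) (dec-false (p ≟ᴾ q) p≢q)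

≡⇒== : {p q : Pt} → p ≡ q → (p == q) ≡ true
≡⇒== {p} {q} p≡q = trans (==-does p q) (dec-true (p ≟ᴾ q) p≡q)

==⇒≡ : {p q : Pt} → (p == q) ≡ true → p ≡ q
==⇒≡ {p} {q} eq with p ≟ᴾ q
... | yes p≡q = p≡q
... | no  p≢q with () ← trans (sym eq) (≢⇒== p≢q)

_⊝_ : Pt → Pt → Pt
p ⊝ s = p ⊕ (⊖ s)

module _ where
  open import Data.Integer.Tactic.RingSolver using (solve-∀)

  private
    ⊝-⊕-coord : ∀ (q s : ℤ) → (q ℤ.+ ℤ.- s) ℤ.+ s ≡ q
    ⊝-⊕-coord = solve-∀
    ⊕-⊝-coord : ∀ (e s : ℤ) → (e ℤ.+ s) ℤ.+ ℤ.- s ≡ e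
    ⊕-⊝-coord = solve-∀

  ⊝-⊕ : (q s : Pt) → (q ⊝ s) ⊕ s ≡ q
  ⊝-⊕ (q₁ , q₂) (s₁ , s₂) = cong₂ _,_ (⊝-⊕-coord q₁ s₁) (⊝-⊕-coord q₂ s₂)

  ⊕-⊝ : (e s : Pt) → (e ⊕ s) ⊝ s ≡ e
  ⊕-⊝ (e₁ , e₂) (s₁ , s₂) = cong₂ _,_ (⊕-⊝-coord e₁ s₁) (⊕-⊝-coord e₂ s₂)

⊕-cancelʳ : (s : Pt) {p q : Pt} → p ⊕ s ≡ q ⊕ s → p ≡ q
⊕-cancelʳ s {p} {q} eq = trans (sym (⊕-⊝ p s)) (trans (cong (_⊝ s) eq) (⊕-⊝ q s))

-- Finite sums

removeFirst : {A : Set} → (A → Bool) → List A → Maybe (List A)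
removeFirst p []       = nothing
removeFirst p (x ∷ xs) = if p x then just xs else Maybe.map (x ∷_) (removeFirst p xs)

permutes : List Pt → List Pt → Bool
permutes []       ys = null ys
permutes (x ∷ xs) ys with removeFirst (_== x) ys
... | just zs = permutes xs zs
... | nothing = false

module ListSum {A : Set} {plus times : Op₂ A} {0ᴬ 1ᴬ : A}
               (isCS : IsCommutativeSemiring _≡_ plus times 0ᴬ 1ᴬ) where
  private
    R : CommutativeSemiring 0ℓ 0ℓ
    R = record { isCommutativeSemiring = isCS }
  open CommutativeSemiring R
    using (_+_; _*_; 0#; +-identityˡ; *-comm; zeroʳ; distribˡ; +-commutativeSemigroup)
  open import Algebra.Properties.CommutativeSemigroup +-commutativeSemigroup using (interchange; x∙yz≈y∙xz)
  open ≡-Reasoning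

  sum : List A → A
  sum = foldr _+_ 0#

  module _ {B : Set} where

    sum-map-cong : {f g : B → A} (xs : List B) → (∀ {x} → x ∈ xs → f x ≡ g x) →
                   sum (map f xs) ≡ sum (map g xs)
    sum-map-cong []       f≗g = refl
    sum-map-cong (x ∷ xs) f≗g = cong₂ _+_ (f≗g (here refl)) (sum-map-cong xs (f≗g ∘ there))

    sum-map-zero : (xs : List B) → sum (map (λ _ → 0#) xs) ≡ 0#
    sum-map-zero []       = refl
    sum-map-zero (x ∷ xs) = trans (+-identityˡ _) (sum-map-zero xs)

    sum-map-+ : (f g : B → A) (xs : List B) →
                sum (map (λ x → f x + g x) xs) ≡ sum (map f xs) + sum (map g xs)
    sum-map-+ f g []       = sym (+-identityˡ 0#)
    sum-map-+ f g (x ∷ xs) = trans (cong (λ z → f x + g x + z) (sum-map-+ f g xs)) (interchange _ _ _ _)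

    *-sum-map : (c : A) (f : B → A) (xs : List B) →
                c * sum (map f xs) ≡ sum (map (λ x → c * f x) xs)
    *-sum-map c f []       = zeroʳ c
    *-sum-map c f (x ∷ xs) = trans (distribˡ c (f x) _) (cong (λ z → c * f x + z) (*-sum-map c f xs))

    sum-map-*ʳ : (f : B → A) (c : A) (xs : List B) →
                 sum (map (λ x → f x * c) xs) ≡ sum (map f xs) * c
    sum-map-*ʳ f c xs = trans (sum-map-cong xs (λ {x} _ → *-comm (f x) c))
                              (trans (sym (*-sum-map c f xs)) (*-comm c _))

  sum-map-comm : {B C : Set} (f : B → C → A) (xs : List B) (ys : List C) →
                 sum (map (λ x → sum (map (f x) ys)) xs) ≡ sum (map (λ y → sum (map (λ x → f x y) xs)) ys)
  sum-map-comm f []       ys = sym (sum-map-zero ys)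
  sum-map-comm f (x ∷ xs) ys = begin
    sum (map (f x) ys) + sum (map (λ x → sum (map (f x) ys)) xs)
      ≡⟨ cong (λ z → sum (map (f x) ys) + z) (sum-map-comm f xs ys) ⟩
    sum (map (f x) ys) + sum (map (λ y → sum (map (λ x → f x y) xs)) ys)
      ≡⟨ sum-map-+ (f x) (λ y → sum (map (λ x → f x y) xs)) ys ⟨
    sum (map (λ y → f x y + sum (map (λ x → f x y) xs)) ys) ∎

  sum-map-removeFirst : {B : Set} (F : B → A) (p : B → Bool) (xs ys : List B) →
    removeFirst p xs ≡ just ys → Σ[ x ∈ B ] T (p x) × sum (map F xs) ≡ F x + sum (map F ys)
  sum-map-removeFirst F p (x ∷ xs) ys eq with p x in px
  sum-map-removeFirst F p (x ∷ xs) .xs refl | true = x , Equivalence.from T-≡ px , refl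
  ... | false with removeFirst p xs in eq′
  sum-map-removeFirst F p (x ∷ xs) .(x ∷ zs) refl | false | just zs
    with y , py , split ← sum-map-removeFirst F p xs zs eq′ =
    y , py , trans (cong (λ z → F x + z) split) (x∙yz≈y∙xz (F x) (F y) _)

  sum-map-permutes : (F : Pt → A) (xs ys : List Pt) → T (permutes xs ys) → sum (map F xs) ≡ sum (map F ys)
  sum-map-permutes F []       []       _    = refl
  sum-map-permutes F (x ∷ xs) ys       perm with removeFirst (_== x) ys in eq
  ... | just zs with y , y==x , split ← sum-map-removeFirst F (_== x) ys zs eq =
    trans (cong₂ _+_ (cong F (sym (==⇒≡ (Equivalence.to T-≡ y==x)))) (sum-map-permutes F xs zs perm)) (sym split)

module ℕΣ = ListSum ℕP.+-*-isCommutativeSemiring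
module ℚΣ = ListSum (CommutativeRing.isCommutativeSemiring ℚP.+-*-commutativeRing)

indicator : Bool → ℕ
indicator b = if b then 1 else 0

-- ℕtoℚ n is definitionally fromℚᵘ (mkℚᵘ (+ n) 0).
ℕtoℚ-+ : (a b : ℕ) → ℕtoℚ (a ℕ.+ b) ≡ ℕtoℚ a ℚ.+ ℕtoℚ b
ℕtoℚ-+ a b = ℚP.toℚᵘ-injective (begin
  ℚ.toℚᵘ (ℕtoℚ (a ℕ.+ b))             ≈⟨ ℚP.toℚᵘ-fromℚᵘ (ℚᵘ.mkℚᵘ (+ (a ℕ.+ b)) 0) ⟩
  ℚᵘ.mkℚᵘ (+ (a ℕ.+ b)) 0             ≈⟨ ℚᵘ.*≡* (cong (ℤ._* 1ℤ) (sym (numerators a b))) ⟩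
  ℚᵘ.mkℚᵘ (+ a) 0 ℚᵘ.+ ℚᵘ.mkℚᵘ (+ b) 0 ≈⟨ ℚᵘP.+-cong (ℚP.toℚᵘ-fromℚᵘ (ℚᵘ.mkℚᵘ (+ a) 0))
                                                       (ℚP.toℚᵘ-fromℚᵘ (ℚᵘ.mkℚᵘ (+ b) 0)) ⟨
  ℚ.toℚᵘ (ℕtoℚ a) ℚᵘ.+ ℚ.toℚᵘ (ℕtoℚ b) ≈⟨ ℚP.toℚᵘ-homo-+ (ℕtoℚ a) (ℕtoℚ b) ⟨
  ℚ.toℚᵘ (ℕtoℚ a ℚ.+ ℕtoℚ b)          ∎)
  where
  open ℚᵘP.≃-Reasoning
  numerators : ∀ a b → + a ℤ.* 1ℤ ℤ.+ + b ℤ.* 1ℤ ≡ + (a ℕ.+ b)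
  numerators a b = trans (cong₂ ℤ._+_ (ℤP.*-identityʳ (+ a)) (ℤP.*-identityʳ (+ b))) (sym (ℤP.pos-+ a b))

ℕtoℚ-sum : (f : A → ℕ) (xs : List A) → ℕtoℚ (ℕΣ.sum (map f xs)) ≡ ℚΣ.sum (map (ℕtoℚ ∘ f) xs)
ℕtoℚ-sum f []       = refl
ℕtoℚ-sum f (x ∷ xs) = trans (ℕtoℚ-+ (f x) _) (cong (ℕtoℚ (f x) ℚ.+_) (ℕtoℚ-sum f xs))

ℕtoℚ-if : (b : Bool) (x : ℕ) → ℕtoℚ (if b then x else 0) ≡ ℕtoℚ (indicator b) ℚ.* ℕtoℚ x
ℕtoℚ-if true  x = sym (ℚP.*-identityˡ (ℕtoℚ x))
ℕtoℚ-if false x = sym (ℚP.*-zeroˡ (ℕtoℚ x))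

countᵇ-∷ : (p : A → Bool) (x : A) (xs : List A) →
           countᵇ p (x ∷ xs) ≡ indicator (p x) ℕ.+ countᵇ p xs
countᵇ-∷ p x xs with p x
... | true  = refl
... | false = refl

countᵇ-cong : {p q : A → Bool} (xs : List A) → (∀ x → p x ≡ q x) → countᵇ p xs ≡ countᵇ q xs
countᵇ-cong {p = p} {q = q} []       p≗q = refl
countᵇ-cong {p = p} {q = q} (x ∷ xs) p≗q = begin
  countᵇ p (x ∷ xs)                   ≡⟨ countᵇ-∷ p x xs ⟩
  indicator (p x) ℕ.+ countᵇ p xs     ≡⟨ cong₂ ℕ._+_ (cong indicator (p≗q x)) (countᵇ-cong xs p≗q) ⟩
  indicator (q x) ℕ.+ countᵇ q xs     ≡⟨ countᵇ-∷ q x xs ⟨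
  countᵇ q (x ∷ xs)                   ∎
  where open ≡-Reasoning

countᵇ-none : {p : A → Bool} (xs : List A) → (∀ x → p x ≡ false) → countᵇ p xs ≡ 0
countᵇ-none {p = p} []       never = refl
countᵇ-none {p = p} (x ∷ xs) never =
  trans (countᵇ-∷ p x xs) (cong₂ ℕ._+_ (cong indicator (never x)) (countᵇ-none xs never))

countᵇ-∧ˡ : (b : Bool) (p : A → Bool) (xs : List A) →
            countᵇ (λ x → b ∧ p x) xs ≡ (if b then countᵇ p xs else 0)
countᵇ-∧ˡ true  p xs = refl
countᵇ-∧ˡ false p xs = countᵇ-none xs (λ _ → refl)

countᵇ-++ : (p : A → Bool) (xs ys : List A) → countᵇ p (xs ++ ys) ≡ countᵇ p xs ℕ.+ countᵇ p ys
countᵇ-++ p []       ys = refl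
countᵇ-++ p (x ∷ xs) ys = begin
  countᵇ p (x ∷ xs ++ ys)                                ≡⟨ countᵇ-∷ p x (xs ++ ys) ⟩
  indicator (p x) ℕ.+ countᵇ p (xs ++ ys)                ≡⟨ cong (indicator (p x) ℕ.+_) (countᵇ-++ p xs ys) ⟩
  indicator (p x) ℕ.+ (countᵇ p xs ℕ.+ countᵇ p ys)      ≡⟨ ℕP.+-assoc (indicator (p x)) _ _ ⟨
  (indicator (p x) ℕ.+ countᵇ p xs) ℕ.+ countᵇ p ys      ≡⟨ cong (ℕ._+ countᵇ p ys) (countᵇ-∷ p x xs) ⟨
  countᵇ p (x ∷ xs) ℕ.+ countᵇ p ys                      ∎
  where open ≡-Reasoning

countᵇ-map : (p : B → Bool) (f : A → B) (xs : List A) → countᵇ p (map f xs) ≡ countᵇ (p ∘ f) xs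
countᵇ-map p f []       = refl
countᵇ-map p f (x ∷ xs) = begin
  countᵇ p (f x ∷ map f xs)                   ≡⟨ countᵇ-∷ p (f x) (map f xs) ⟩
  indicator (p (f x)) ℕ.+ countᵇ p (map f xs) ≡⟨ cong (indicator (p (f x)) ℕ.+_) (countᵇ-map p f xs) ⟩
  indicator (p (f x)) ℕ.+ countᵇ (p ∘ f) xs   ≡⟨ countᵇ-∷ (p ∘ f) x xs ⟨
  countᵇ (p ∘ f) (x ∷ xs)                     ∎
  where open ≡-Reasoning

countᵇ-concatMap : (p : B → Bool) (f : A → List B) (xs : List A) →
                   countᵇ p (concatMap f xs) ≡ ℕΣ.sum (map (countᵇ p ∘ f) xs)
countᵇ-concatMap p f []       = refl
countᵇ-concatMap p f (x ∷ xs) =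
  trans (countᵇ-++ p (f x) (concatMap f xs)) (cong (countᵇ p (f x) ℕ.+_) (countᵇ-concatMap p f xs))

∧-true : {a b : Bool} → a ∧ b ≡ true → (a ≡ true) × (b ≡ true)
∧-true {true} {true} _ = refl , refl

allᵇ-∷ʳ : (f : A → Bool) (xs : List A) (x : A) → allᵇ f (xs ∷ʳ x) ≡ allᵇ f xs ∧ f x
allᵇ-∷ʳ f []       x = ∧-identityʳ (f x)
allᵇ-∷ʳ f (y ∷ xs) x = trans (cong (f y ∧_) (allᵇ-∷ʳ f xs x)) (sym (∧-assoc (f y) _ (f x)))

allᵇ-∈ : (p : A → Bool) {xs : List A} → T (allᵇ p xs) → ∀ {x} → x ∈ xs → T (p x)
allᵇ-∈ p {y ∷ xs} all-p (here refl) = proj₁ (Equivalence.to (T-∧ {p y}) all-p)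
allᵇ-∈ p {y ∷ xs} all-p (there x∈) = allᵇ-∈ p (proj₂ (Equivalence.to (T-∧ {p y}) all-p)) x∈

-- Walks, decomposed by their last step

open import Algebra.Properties.CommutativeSemigroup
  (CommutativeMonoid.commutativeSemigroup ∧-commutativeMonoid) using () renaming (interchange to ∧-interchange)

countᵇ-walks : (m : Model) (n : ℕ) (P : List Pt → Bool) →
  countᵇ P (walks m (suc n)) ≡ ℕΣ.sum (map (λ s → countᵇ (P ∘ (s ∷_)) (walks m n)) (steps m))
countᵇ-walks m n P = trans (countᵇ-concatMap P (λ s → map (s ∷_) (walks m n)) (steps m))
                           (ℕΣ.sum-map-cong (steps m) (λ {s} _ → countᵇ-map P (s ∷_) (walks m n)))

countᵇ-walks-∷ʳ : (m : Model) (n : ℕ) (P : List Pt → Bool) →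
  countᵇ P (walks m (suc n)) ≡ ℕΣ.sum (map (λ s → countᵇ (λ w → P (w ∷ʳ s)) (walks m n)) (steps m))
countᵇ-walks-∷ʳ m zero    P = trans (countᵇ-walks m zero P)
  (ℕΣ.sum-map-cong (steps m) (λ {s} _ →
    trans (countᵇ-∷ (P ∘ (s ∷_)) [] []) (sym (countᵇ-∷ (λ w → P (w ∷ʳ s)) [] []))))
countᵇ-walks-∷ʳ m (suc n) P = begin
  countᵇ P (walks m (suc (suc n)))
    ≡⟨ countᵇ-walks m (suc n) P ⟩
  ℕΣ.sum (map (λ s → countᵇ (P ∘ (s ∷_)) (walks m (suc n))) (steps m))
    ≡⟨ ℕΣ.sum-map-cong (steps m) (λ {s} _ → countᵇ-walks-∷ʳ m n (P ∘ (s ∷_))) ⟩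
  ℕΣ.sum (map (λ s → ℕΣ.sum (map (λ t → countᵇ (λ w → P (s ∷ w ∷ʳ t)) (walks m n)) (steps m))) (steps m))
    ≡⟨ ℕΣ.sum-map-comm (λ s t → countᵇ (λ w → P (s ∷ w ∷ʳ t)) (walks m n)) (steps m) (steps m) ⟩
  ℕΣ.sum (map (λ t → ℕΣ.sum (map (λ s → countᵇ (λ w → P (s ∷ w ∷ʳ t)) (walks m n)) (steps m))) (steps m))
    ≡⟨ ℕΣ.sum-map-cong (steps m) (λ {t} _ → countᵇ-walks m n (λ w → P (w ∷ʳ t))) ⟨
  ℕΣ.sum (map (λ t → countᵇ (λ w → P (w ∷ʳ t)) (walks m (suc n))) (steps m)) ∎
  where open ≡-Reasoning

endpoint-∷ʳ : (p : Pt) (w : List Pt) (s : Pt) → endpoint p (w ∷ʳ s) ≡ endpoint p w ⊕ s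
endpoint-∷ʳ p []      s = refl
endpoint-∷ʳ p (t ∷ w) s = endpoint-∷ʳ (p ⊕ t) w s

vertices-∷ʳ : (p : Pt) (w : List Pt) (s : Pt) → vertices p (w ∷ʳ s) ≡ vertices p w ∷ʳ (endpoint p w ⊕ s)
vertices-∷ʳ p []      s = refl
vertices-∷ʳ p (t ∷ w) s = cong (p ∷_) (vertices-∷ʳ (p ⊕ t) w s)

allᵇ-vertices-endpoint : (f : Pt → Bool) (p : Pt) (w : List Pt) →
                         allᵇ f (vertices p w) ≡ true → f (endpoint p w) ≡ true
allᵇ-vertices-endpoint f p []      all-f with f p
... | true = refl
allᵇ-vertices-endpoint f p (s ∷ w) all-f with f p
... | true = allᵇ-vertices-endpoint f (p ⊕ s) w all-f

-- The head of 'vertices q w' is only exposed once w is split, hence the three clauses.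
noForbidden-∷ʳ : (p : Pt) (w : List Pt) (x : Pt) →
  noForbidden (vertices p w ∷ʳ x) ≡ noForbidden (vertices p w) ∧ not (forbiddenStep (endpoint p w) x)
noForbidden-∷ʳ p []          x = ∧-identityʳ _
noForbidden-∷ʳ p (s ∷ [])    x =
  trans (cong (not (forbiddenStep p (p ⊕ s)) ∧_) (noForbidden-∷ʳ (p ⊕ s) [] x))
        (sym (∧-assoc (not (forbiddenStep p (p ⊕ s))) true _))
noForbidden-∷ʳ p (s ∷ t ∷ w) x =
  trans (cong (not (forbiddenStep p (p ⊕ s)) ∧_) (noForbidden-∷ʳ (p ⊕ s) (t ∷ w) x))
        (sym (∧-assoc (not (forbiddenStep p (p ⊕ s))) (noForbidden (vertices (p ⊕ s) (t ∷ w))) _))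

coneStep : Pt → Pt → Bool
coneStep e e′ = inCone e′ ∧ not (forbiddenStep e e′)

coneWalk-∷ʳ : (w : List Pt) (s : Pt) →
  coneWalk (w ∷ʳ s) ≡ coneWalk w ∧ coneStep (endpoint origin w) (endpoint origin w ⊕ s)
coneWalk-∷ʳ w s rewrite vertices-∷ʳ origin w s
                      | allᵇ-∷ʳ inCone (vertices origin w) (endpoint origin w ⊕ s)
                      | noForbidden-∷ʳ origin w (endpoint origin w ⊕ s)
  = ∧-interchange (allᵇ inCone (vertices origin w)) (inCone (endpoint origin w ⊕ s))
                  (noForbidden (vertices origin w)) _

quadrantWalk-∷ʳ : (w : List Pt) (s : Pt) →
  quadrantWalk (w ∷ʳ s) ≡ quadrantWalk w ∧ inQuadrant (endpoint origin w ⊕ s)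
quadrantWalk-∷ʳ w s rewrite vertices-∷ʳ origin w s = allᵇ-∷ʳ inQuadrant (vertices origin w) _

walksTo : (List Pt → Bool) → Model → ℕ → Pt → ℕ
walksTo P m n q = countᵇ (λ w → P w ∧ (endpoint origin w == q)) (walks m n)

walksTo-suc : (P : List Pt → Bool) (R : Pt → Pt → Bool) →
  (∀ w s → P (w ∷ʳ s) ≡ P w ∧ R (endpoint origin w) (endpoint origin w ⊕ s)) →
  (m : Model) (n : ℕ) (q : Pt) →
  walksTo P m (suc n) q ≡
    ℕΣ.sum (map (λ s → if R (q ⊝ s) q then walksTo P m n (q ⊝ s) else 0) (steps m))
walksTo-suc P R P-∷ʳ m n q = trans (countᵇ-walks-∷ʳ m n _) (ℕΣ.sum-map-cong (steps m) λ {s} _ →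
  trans (countᵇ-cong (walks m n) (λ w → last-step w s))
        (countᵇ-∧ˡ (R (q ⊝ s) q) (λ w → P w ∧ (endpoint origin w == (q ⊝ s))) (walks m n)))
  where
  last-step : ∀ w s → P (w ∷ʳ s) ∧ (endpoint origin (w ∷ʳ s) == q)
                      ≡ R (q ⊝ s) q ∧ (P w ∧ (endpoint origin w == (q ⊝ s)))
  last-step w s rewrite P-∷ʳ w s | endpoint-∷ʳ origin w s = shifted (P w) (endpoint origin w) s
    where
    open ≡-Reasoning
    shifted : (b : Bool) (e t : Pt) →
              (b ∧ R e (e ⊕ t)) ∧ ((e ⊕ t) == q) ≡ R (q ⊝ t) q ∧ (b ∧ (e == (q ⊝ t)))
    shifted b e t with e ≟ᴾ q ⊝ t
    ... | yes refl = begin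
      (b ∧ R (q ⊝ t) ((q ⊝ t) ⊕ t)) ∧ (((q ⊝ t) ⊕ t) == q)
        ≡⟨ cong (λ x → (b ∧ R (q ⊝ t) x) ∧ (x == q)) (⊝-⊕ q t) ⟩
      (b ∧ R (q ⊝ t) q) ∧ (q == q)
        ≡⟨ cong ((b ∧ R (q ⊝ t) q) ∧_) (≡⇒== {q} refl) ⟩
      (b ∧ R (q ⊝ t) q) ∧ true
        ≡⟨ trans (∧-identityʳ _) (trans (∧-comm b _) (cong (R (q ⊝ t) q ∧_) (sym (∧-identityʳ b)))) ⟩
      R (q ⊝ t) q ∧ (b ∧ true)
        ≡⟨ cong (λ c → R (q ⊝ t) q ∧ (b ∧ c)) (≡⇒== {q ⊝ t} refl) ⟨
      R (q ⊝ t) q ∧ (b ∧ ((q ⊝ t) == (q ⊝ t))) ∎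
    ... | no e≢q⊝t rewrite ≢⇒== e≢q⊝t
                         | ≢⇒== {e ⊕ t} {q} (λ e⊕t≡q → e≢q⊝t (trans (sym (⊕-⊝ e t)) (cong (_⊝ t) e⊕t≡q))) =
      trans (∧-zeroʳ _) (sym (trans (cong (R (q ⊝ t) q ∧_) (∧-zeroʳ b)) (∧-zeroʳ _)))

walksTo-outside : (P : List Pt → Bool) (V : Pt → Bool) →
  (∀ w → P w ≡ true → V (endpoint origin w) ≡ true) →
  (m : Model) (n : ℕ) {q : Pt} → V q ≡ false → walksTo P m n q ≡ 0
walksTo-outside P V P⇒V m n {q} Vq = countᵇ-none (walks m n) avoids-q
  where
  avoids-q : ∀ w → (P w ∧ (endpoint origin w == q)) ≡ false
  avoids-q w with P w in Pw | endpoint origin w ≟ᴾ q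
  ... | false | _     = refl
  ... | true  | no ne = ≢⇒== ne
  ... | true  | yes e with () ← trans (sym (P⇒V w Pw)) (trans (cong V e) Vq)

coneCount quadrantCount : Model → ℕ → Pt → ℕ
coneCount     = walksTo coneWalk
quadrantCount = walksTo quadrantWalk

coneCount-suc : (m : Model) (n : ℕ) (q : Pt) → coneCount m (suc n) q ≡
  ℕΣ.sum (map (λ s → if coneStep (q ⊝ s) q then coneCount m n (q ⊝ s) else 0) (steps m))
coneCount-suc = walksTo-suc coneWalk coneStep coneWalk-∷ʳ

quadrantCount-suc : (m : Model) (n : ℕ) (q : Pt) → quadrantCount m (suc n) q ≡
  ℕΣ.sum (map (λ s → if inQuadrant q then quadrantCount m n (q ⊝ s) else 0) (steps m))
quadrantCount-suc = walksTo-suc quadrantWalk (λ _ → inQuadrant) quadrantWalk-∷ʳ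

quadrantWalk-endpoint : (w : List Pt) → quadrantWalk w ≡ true → inQuadrant (endpoint origin w) ≡ true
quadrantWalk-endpoint = allᵇ-vertices-endpoint inQuadrant origin

coneCount-outside : (m : Model) (n : ℕ) {q : Pt} → inCone q ≡ false → coneCount m n q ≡ 0
coneCount-outside = walksTo-outside coneWalk inCone
  (λ w cw → allᵇ-vertices-endpoint inCone origin w (proj₁ (∧-true cw)))

quadrantCount-outside : (m : Model) (n : ℕ) {q : Pt} → inQuadrant q ≡ false → quadrantCount m n q ≡ 0
quadrantCount-outside = walksTo-outside quadrantWalk inQuadrant quadrantWalk-endpoint

coneCount-zero : (m : Model) (q : Pt) → coneCount m 0 q ≡ indicator (origin == q)
coneCount-zero m q = trans (countᵇ-∷ (λ w → coneWalk w ∧ (endpoint origin w == q)) [] []) (ℕP.+-identityʳ _)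

quadrantCount-zero : (m : Model) (q : Pt) → quadrantCount m 0 q ≡ indicator (origin == q)
quadrantCount-zero m q = trans (countᵇ-∷ (λ w → quadrantWalk w ∧ (endpoint origin w == q)) [] []) (ℕP.+-identityʳ _)

inQuadrant-ℕ : (q : Pt) → inQuadrant q ≡ true → Σ[ a ∈ ℕ ] Σ[ b ∈ ℕ ] q ≡ (+ a , + b)
inQuadrant-ℕ (+ a , + b)          _  = a , b , refl
inQuadrant-ℕ (+ a , -[1+ _ ])     in𝒬 with () ← trans (sym in𝒬) (∧-zeroʳ (0ℤ ℤ.≤ᵇ + a))

-- The action of G on points of the quadrant

Row : Set
Row = ℤ × ℤ

row₁ row₂ : Subst → Row
row₁ ((U₁ , U₂) , (V₁ , V₂)) = (U₁ , V₁)
row₂ ((U₁ , U₂) , (V₁ , V₂)) = (U₂ , V₂)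

weighted : ℕ → ℕ → Row → ℤ
weighted i j (u , v) = (+ i ℤ.+ 1ℤ) ℤ.* u ℤ.+ (+ j ℤ.+ 1ℤ) ℤ.* v

coordinate : ℕ → ℕ → Row → ℤ
coordinate i j r = weighted i j r ℤ.+ -1ℤ

dot-coordinates : (g : Subst) (i j : ℕ) →
                  dot g (+ i , + j) ≡ (coordinate i j (row₁ g) , coordinate i j (row₂ g))
dot-coordinates ((U₁ , U₂) , (V₁ , V₂)) i j = refl

scale-nonneg : ∀ k {w} → 0ℤ ℤ.≤ w → 0ℤ ℤ.≤ + k ℤ.* w
scale-nonneg k 0≤w = ℤP.≤-trans (ℤP.≤-reflexive (sym (ℤP.*-zeroʳ (+ k)))) (ℤP.*-monoˡ-≤-nonNeg (+ k) 0≤w)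

scale-nonpos : ∀ k {w} → w ℤ.≤ 0ℤ → + k ℤ.* w ℤ.≤ 0ℤ
scale-nonpos k w≤0 = ℤP.≤-trans (ℤP.*-monoˡ-≤-nonNeg (+ k) w≤0) (ℤP.≤-reflexive (ℤP.*-zeroʳ (+ k)))

rowSum : Row → ℤ
rowSum (u , v) = u ℤ.+ v

module _ where
  open import Data.Integer.Tactic.RingSolver using (solve-∀)

  private
    weighted-split : ∀ (i j u v : ℤ) →
      (u ℤ.+ v) ℤ.+ (i ℤ.* u ℤ.+ j ℤ.* v) ≡ (i ℤ.+ 1ℤ) ℤ.* u ℤ.+ (j ℤ.+ 1ℤ) ℤ.* v
    weighted-split = solve-∀

  rowSum≤weighted : ∀ i j {u v : ℤ} → 0ℤ ℤ.≤ u → 0ℤ ℤ.≤ v → rowSum (u , v) ℤ.≤ weighted i j (u , v)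
  rowSum≤weighted i j {u} {v} 0≤u 0≤v =
    subst₂ ℤ._≤_ (ℤP.+-identityʳ (u ℤ.+ v)) (weighted-split (+ i) (+ j) u v)
      (ℤP.+-monoʳ-≤ (u ℤ.+ v) (ℤP.+-mono-≤ (scale-nonneg i 0≤u) (scale-nonneg j 0≤v)))

  weighted≤rowSum : ∀ i j {u v : ℤ} → u ℤ.≤ 0ℤ → v ℤ.≤ 0ℤ → weighted i j (u , v) ℤ.≤ rowSum (u , v)
  weighted≤rowSum i j {u} {v} u≤0 v≤0 =
    subst₂ ℤ._≤_ (weighted-split (+ i) (+ j) u v) (ℤP.+-identityʳ (u ℤ.+ v))
      (ℤP.+-monoʳ-≤ (u ℤ.+ v) (ℤP.+-mono-≤ (scale-nonpos i u≤0) (scale-nonpos j v≤0)))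

bothNonneg bothNonpos positiveRow farRow : Row → Bool
bothNonneg (u , v) = (0ℤ ℤ.≤ᵇ u) ∧ (0ℤ ℤ.≤ᵇ v)
bothNonpos (u , v) = (u ℤ.≤ᵇ 0ℤ) ∧ (v ℤ.≤ᵇ 0ℤ)
positiveRow r = bothNonneg r ∧ (1ℤ ℤ.≤ᵇ rowSum r)
farRow r = (bothNonneg r ∧ (+ 2 ℤ.≤ᵇ rowSum r)) ∨ (bothNonpos r ∧ (rowSum r ℤ.≤ᵇ -1ℤ))

bothNonneg-weighted : ∀ i j r → T (bothNonneg r) → rowSum r ℤ.≤ weighted i j r
bothNonneg-weighted i j (u , v) nn with Equivalence.to T-∧ nn
... | 0≤u , 0≤v = rowSum≤weighted i j (ℤP.≤ᵇ⇒≤ 0≤u) (ℤP.≤ᵇ⇒≤ 0≤v)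

bothNonpos-weighted : ∀ i j r → T (bothNonpos r) → weighted i j r ℤ.≤ rowSum r
bothNonpos-weighted i j (u , v) np with Equivalence.to T-∧ np
... | u≤0 , v≤0 = weighted≤rowSum i j (ℤP.≤ᵇ⇒≤ u≤0) (ℤP.≤ᵇ⇒≤ v≤0)

positiveRow-weighted : ∀ i j r → T (positiveRow r) → 1ℤ ℤ.≤ weighted i j r
positiveRow-weighted i j r pos with Equivalence.to T-∧ pos
... | nn , 1≤sum = ℤP.≤-trans (ℤP.≤ᵇ⇒≤ {1ℤ} 1≤sum) (bothNonneg-weighted i j r nn)

positiveRow-coordinate : ∀ i j r → T (positiveRow r) → 0ℤ ℤ.≤ coordinate i j r
positiveRow-coordinate i j r pos = ℤP.+-monoˡ-≤ -1ℤ (positiveRow-weighted i j r pos)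

bothNonpos-weighted≤0 : ∀ i j r → T (bothNonpos r) → weighted i j r ℤ.≤ 0ℤ
bothNonpos-weighted≤0 i j r@(u , v) np with Equivalence.to T-∧ np
... | u≤0 , v≤0 =
  ℤP.≤-trans (bothNonpos-weighted i j r np) (ℤP.+-mono-≤ (ℤP.≤ᵇ⇒≤ {u} {0ℤ} u≤0) (ℤP.≤ᵇ⇒≤ {v} {0ℤ} v≤0))

Off0-1 : ℤ → Set
Off0-1 c = ¬ c ≡ 0ℤ × ¬ c ≡ -1ℤ

farRow-coordinate : ∀ i j r → T (farRow r) → Off0-1 (coordinate i j r)
farRow-coordinate i j r far with Equivalence.to T-∨ far
... | inj₁ big with Equivalence.to T-∧ big
...   | nn , 2≤sum = above (ℤP.+-monoˡ-≤ -1ℤ (ℤP.≤-trans (ℤP.≤ᵇ⇒≤ {+ 2} 2≤sum) (bothNonneg-weighted i j r nn)))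
  where
  above : ∀ {c} → 1ℤ ℤ.≤ c → Off0-1 c
  above (ℤ.+≤+ (ℕ.s≤s _)) = (λ ()) , (λ ())
farRow-coordinate i j r far | inj₂ small with Equivalence.to T-∧ small
...   | np , sum≤-1 = below (ℤP.+-monoˡ-≤ -1ℤ (ℤP.≤-trans (bothNonpos-weighted i j r np) (ℤP.≤ᵇ⇒≤ sum≤-1)))
  where
  below : ∀ {c} → c ℤ.≤ -[1+ 1 ] → Off0-1 c
  below (ℤ.-≤- (ℕ.s≤s _)) = (λ ()) , (λ ())

AvoidsCorners : Pt → Set
AvoidsCorners q = ¬ q ≡ (0ℤ , -1ℤ) × ¬ q ≡ (-1ℤ , 0ℤ)

forbiddenStep-avoiding : (x : Pt) {q : Pt} → AvoidsCorners q → forbiddenStep x q ≡ false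
forbiddenStep-avoiding x (q≢a , q≢b)
  rewrite ≢⇒== q≢a | ≢⇒== q≢b | ∧-zeroʳ (x == (-1ℤ , 0ℤ)) | ∧-zeroʳ (x == (0ℤ , -1ℤ)) = refl

safe : Subst → Bool
safe g = (positiveRow (row₁ g) ∨ positiveRow (row₂ g))
       ∧ ((farRow (row₁ g) ∨ farRow (row₂ g)) ∨ (positiveRow (row₁ g) ∧ positiveRow (row₂ g)))

safe-coneStep : (g : Subst) → T (safe g) → (i j : ℕ) (x : Pt) → coneStep x (dot g (+ i , + j)) ≡ true
safe-coneStep g sg i j x rewrite dot-coordinates g i j with Equivalence.to T-∧ sg
... | cone , corners =
  cong₂ _∧_ (Equivalence.to T-≡ (Equivalence.from T-∨ (Sum.map nonneg nonneg (Equivalence.to T-∨ cone))))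
            (cong not (forbiddenStep-avoiding x (avoids (Equivalence.to T-∨ corners))))
  where
  c₁ c₂ : ℤ
  c₁ = coordinate i j (row₁ g)
  c₂ = coordinate i j (row₂ g)
  nonneg : ∀ {r} → T (positiveRow r) → T (0ℤ ℤ.≤ᵇ coordinate i j r)
  nonneg {r} pos = ℤP.≤⇒≤ᵇ (positiveRow-coordinate i j r pos)
  ≢-1 : ∀ {c} → 0ℤ ℤ.≤ c → ¬ c ≡ -1ℤ
  ≢-1 (ℤ.+≤+ _) ()
  avoids : T (farRow (row₁ g) ∨ farRow (row₂ g)) ⊎ T (positiveRow (row₁ g) ∧ positiveRow (row₂ g)) →
           AvoidsCorners (c₁ , c₂)
  avoids (inj₁ far) with Equivalence.to T-∨ far
  ... | inj₁ far₁ = let (≢0 , ≢-1′) = farRow-coordinate i j (row₁ g) far₁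
                    in (≢0 ∘ cong proj₁) , (≢-1′ ∘ cong proj₁)
  ... | inj₂ far₂ = let (≢0 , ≢-1′) = farRow-coordinate i j (row₂ g) far₂
                    in (≢-1′ ∘ cong proj₂) , (≢0 ∘ cong proj₂)
  avoids (inj₂ both) with Equivalence.to T-∧ both
  ... | pos₁ , pos₂ = (≢-1 (positiveRow-coordinate i j (row₂ g) pos₂) ∘ cong proj₂)
                    , (≢-1 (positiveRow-coordinate i j (row₁ g) pos₁) ∘ cong proj₁)

det : Subst → ℤ
det ((U₁ , U₂) , (V₁ , V₂)) = U₁ ℤ.* V₂ ℤ.- V₁ ℤ.* U₂

pullback : Row → Subst → Row
pullback (l₁ , l₂) ((U₁ , U₂) , (V₁ , V₂)) = (l₁ ℤ.* U₁ ℤ.+ l₂ ℤ.* U₂ , l₁ ℤ.* V₁ ℤ.+ l₂ ℤ.* V₂)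

evaluate : Row → Pt → ℤ
evaluate (l₁ , l₂) (x₁ , x₂) = l₁ ℤ.* x₁ ℤ.+ l₂ ℤ.* x₂

module _ where
  open import Data.Integer.Tactic.RingSolver using (solve-∀)

  private
    linear-coord : ∀ (a b s t u v : ℤ) →
      ((a ℤ.+ ℤ.- s) ℤ.+ 1ℤ) ℤ.* u ℤ.+ ((b ℤ.+ ℤ.- t) ℤ.+ 1ℤ) ℤ.* v ℤ.+ -1ℤ
      ≡ ((a ℤ.+ 1ℤ) ℤ.* u ℤ.+ (b ℤ.+ 1ℤ) ℤ.* v ℤ.+ -1ℤ) ℤ.+ ℤ.- (s ℤ.* u ℤ.+ t ℤ.* v)
    linear-coord = solve-∀

    adjugate₁ : ∀ (a b U₁ U₂ V₁ V₂ : ℤ) →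
      (V₂ ℤ.* (a ℤ.* U₁ ℤ.+ b ℤ.* V₁) ℤ.- V₁ ℤ.* (a ℤ.* U₂ ℤ.+ b ℤ.* V₂)) ℤ.* (U₁ ℤ.* V₂ ℤ.- V₁ ℤ.* U₂)
      ≡ a ℤ.* ((U₁ ℤ.* V₂ ℤ.- V₁ ℤ.* U₂) ℤ.* (U₁ ℤ.* V₂ ℤ.- V₁ ℤ.* U₂))
    adjugate₁ = solve-∀

    adjugate₂ : ∀ (a b U₁ U₂ V₁ V₂ : ℤ) →
      (U₁ ℤ.* (a ℤ.* U₂ ℤ.+ b ℤ.* V₂) ℤ.- U₂ ℤ.* (a ℤ.* U₁ ℤ.+ b ℤ.* V₁)) ℤ.* (U₁ ℤ.* V₂ ℤ.- V₁ ℤ.* U₂)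
      ≡ b ℤ.* ((U₁ ℤ.* V₂ ℤ.- V₁ ℤ.* U₂) ℤ.* (U₁ ℤ.* V₂ ℤ.- V₁ ℤ.* U₂))
    adjugate₂ = solve-∀

    evaluate-coord : ∀ (l₁ l₂ a b U₁ U₂ V₁ V₂ : ℤ) →
      l₁ ℤ.* (a ℤ.* U₁ ℤ.+ b ℤ.* V₁) ℤ.+ l₂ ℤ.* (a ℤ.* U₂ ℤ.+ b ℤ.* V₂)
      ≡ a ℤ.* (l₁ ℤ.* U₁ ℤ.+ l₂ ℤ.* U₂) ℤ.+ b ℤ.* (l₁ ℤ.* V₁ ℤ.+ l₂ ℤ.* V₂)
    evaluate-coord = solve-∀

  dot-⊝ : (g : Subst) (p s : Pt) → dot g (p ⊝ s) ≡ dot g p ⊝ applyMono g s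
  dot-⊝ ((U₁ , U₂) , (V₁ , V₂)) (a , b) (s , t) =
    cong₂ _,_ (linear-coord a b s t U₁ V₁) (linear-coord a b s t U₂ V₂)

  applyMono-injective : (g : Subst) → det g ℤ.* det g ≡ 1ℤ →
                        {p q : Pt} → applyMono g p ≡ applyMono g q → p ≡ q
  applyMono-injective g@((U₁ , U₂) , (V₁ , V₂)) unimodular {a , b} {c , d} eq =
    cong₂ _,_ (recover (trans (sym (adjugate₁ a b U₁ U₂ V₁ V₂))
                       (trans (cong (λ x → (V₂ ℤ.* proj₁ x ℤ.- V₁ ℤ.* proj₂ x) ℤ.* det g) eq)
                              (adjugate₁ c d U₁ U₂ V₁ V₂))))
              (recover (trans (sym (adjugate₂ a b U₁ U₂ V₁ V₂))
                       (trans (cong (λ x → (U₁ ℤ.* proj₂ x ℤ.- U₂ ℤ.* proj₁ x) ℤ.* det g) eq)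
                              (adjugate₂ c d U₁ U₂ V₁ V₂))))
    where
    recover : ∀ {x y} → x ℤ.* (det g ℤ.* det g) ≡ y ℤ.* (det g ℤ.* det g) → x ≡ y
    recover {x} {y} eq rewrite unimodular = trans (sym (ℤP.*-identityʳ x)) (trans eq (ℤP.*-identityʳ y))

  evaluate-applyMono : (l : Row) (g : Subst) (i j : ℕ) →
    evaluate l (applyMono g (+ i ℤ.+ 1ℤ , + j ℤ.+ 1ℤ)) ≡ weighted i j (pullback l g)
  evaluate-applyMono (l₁ , l₂) ((U₁ , U₂) , (V₁ , V₂)) i j =
    evaluate-coord l₁ l₂ (+ i ℤ.+ 1ℤ) (+ j ℤ.+ 1ℤ) U₁ U₂ V₁ V₂

dot-injective : (g : Subst) → det g ℤ.* det g ≡ 1ℤ → {p q : Pt} → dot g p ≡ dot g q → p ≡ q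
dot-injective g unimodular eq =
  ⊕-cancelʳ (1ℤ , 1ℤ) (applyMono-injective g unimodular (⊕-cancelʳ (-1ℤ , -1ℤ) eq))

separates : Row → Subst → Subst → Bool
separates l h g = positiveRow (pullback l h) ∧ bothNonpos (pullback l g)

separates-disjoint : (l : Row) (h g : Subst) → T (separates l h g) →
                     (i j k k′ : ℕ) → ¬ dot h (+ i , + j) ≡ dot g (+ k , + k′)
separates-disjoint l h g sep i j k k′ eq with Equivalence.to T-∧ sep
... | pos , np = 1≰0 (begin
  1ℤ                                                  ≤⟨ positiveRow-weighted i j (pullback l h) pos ⟩
  weighted i j (pullback l h)                         ≡⟨ evaluate-applyMono l h i j ⟨
  evaluate l (applyMono h (+ i ℤ.+ 1ℤ , + j ℤ.+ 1ℤ))   ≡⟨ cong (evaluate l) (⊕-cancelʳ (-1ℤ , -1ℤ) eq) ⟩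
  evaluate l (applyMono g (+ k ℤ.+ 1ℤ , + k′ ℤ.+ 1ℤ))  ≡⟨ evaluate-applyMono l g k k′ ⟩
  weighted k k′ (pullback l g)                        ≤⟨ bothNonpos-weighted≤0 k k′ (pullback l g) np ⟩
  0ℤ                                                  ∎)
  where
  open ℤP.≤-Reasoning
  1≰0 : ¬ 1ℤ ℤ.≤ 0ℤ
  1≰0 (ℤ.+≤+ ())

_≟ˢ_ : DecidableEquality Subst
_≟ˢ_ = ≡-dec _≟ᴾ_ _≟ᴾ_

candidateFunctionals : List Row
candidateFunctionals = cartesianProduct small small
  where
  small : List ℤ
  small = -[1+ 1 ] ∷ -1ℤ ∷ 0ℤ ∷ 1ℤ ∷ + 2 ∷ []

unimodular : Subst → Bool
unimodular g = does (det g ℤ.* det g ℤ.≟ 1ℤ)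

unimodular-det : (g : Subst) → T (unimodular g) → det g ℤ.* det g ≡ 1ℤ
unimodular-det g ok with det g ℤ.* det g ℤ.≟ 1ℤ
... | yes d²≡1 = d²≡1

-- ġ is injective if h = g; otherwise some candidate functional separates ḣ(𝒬) from ġ(𝒬).
coincideOrSeparate : Subst → Subst → Bool
coincideOrSeparate h g =
  if does (h ≟ˢ g) then unimodular g else any (λ l → separates l h g) candidateFunctionals

dot-==-dot : (h g : Subst) → T (coincideOrSeparate h g) → (i j k k′ : ℕ) →
  (dot h (+ i , + j) == dot g (+ k , + k′)) ≡ does (h ≟ˢ g) ∧ ((+ i , + j) == (+ k , + k′))
dot-==-dot h g ok i j k k′ = by-cases (h ≟ˢ g) ok
  where
  by-cases : (h≟g : Dec (h ≡ g)) →
    T (if does h≟g then unimodular g else any (λ l → separates l h g) candidateFunctionals) →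
    (dot h (+ i , + j) == dot g (+ k , + k′)) ≡ does h≟g ∧ ((+ i , + j) == (+ k , + k′))
  by-cases (no _) ok with l , sep ← satisfied (any⁻ (λ l → separates l h g) candidateFunctionals ok) =
    ≢⇒== (separates-disjoint l h g sep i j k k′)
  by-cases (yes refl) ok with (+ i , + j) ≟ᴾ (+ k , + k′)
  ... | yes p≡q = trans (≡⇒== (cong (dot h) p≡q)) (sym (≡⇒== p≡q))
  ... | no  p≢q = trans (≢⇒== (p≢q ∘ dot-injective g (unimodular-det g ok))) (sym (≢⇒== p≢q))

dot-left : (g : Subst) (y : ℤ) → dot g (-1ℤ , y) ≡ ((y ℤ.+ 1ℤ) ⊛ proj₂ g) ⊕ (-1ℤ , -1ℤ)
dot-left ((U₁ , U₂) , (V₁ , V₂)) y =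
  cong₂ _,_ (cong (ℤ._+ -1ℤ) (ℤP.+-identityˡ ((y ℤ.+ 1ℤ) ℤ.* V₁)))
            (cong (ℤ._+ -1ℤ) (ℤP.+-identityˡ ((y ℤ.+ 1ℤ) ℤ.* V₂)))

dot-bottom : (g : Subst) (x : ℤ) → dot g (x , -1ℤ) ≡ ((x ℤ.+ 1ℤ) ⊛ proj₁ g) ⊕ (-1ℤ , -1ℤ)
dot-bottom ((U₁ , U₂) , (V₁ , V₂)) x =
  cong₂ _,_ (cong (ℤ._+ -1ℤ) (ℤP.+-identityʳ ((x ℤ.+ 1ℤ) ℤ.* U₁)))
            (cong (ℤ._+ -1ℤ) (ℤP.+-identityʳ ((x ℤ.+ 1ℤ) ℤ.* U₂)))

scaled-nonpos-outside : (k : ℕ) (V : Pt) → T (bothNonpos V) → inCone (((+ k) ⊛ V) ⊕ (-1ℤ , -1ℤ)) ≡ false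
scaled-nonpos-outside k (v₁ , v₂) np with Equivalence.to T-∧ np
... | v₁≤0 , v₂≤0 =
  cong₂ _∨_ (negative (ℤP.≤ᵇ⇒≤ {v₁} {0ℤ} v₁≤0)) (negative (ℤP.≤ᵇ⇒≤ {v₂} {0ℤ} v₂≤0))
  where
  below-0 : ∀ {c} → c ℤ.≤ -1ℤ → (0ℤ ℤ.≤ᵇ c) ≡ false
  below-0 (ℤ.-≤- _) = refl
  negative : ∀ {v} → v ℤ.≤ 0ℤ → (0ℤ ℤ.≤ᵇ (+ k ℤ.* v ℤ.+ -1ℤ)) ≡ false
  negative v≤0 = below-0 (ℤP.+-monoˡ-≤ -1ℤ (scale-nonpos k v≤0))

-- Cancellation on the boundary lines

opposite : ℚ → Pt → ℚ × Pt → Bool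
opposite w V (w′ , V′) = (V′ == V) ∧ does (w′ ℚ.≟ ℚ.- w)

opposite-sound : ∀ {w V w′ V′} → T (opposite w V (w′ , V′)) → w′ ≡ ℚ.- w × V′ ≡ V
opposite-sound {w} {V} {w′} {V′} opp with w′ ℚ.≟ ℚ.- w | Equivalence.to (T-∧ {V′ == V}) opp
... | yes w′≡-w | V′==V , _ = w′≡-w , ==⇒≡ (Equivalence.to T-≡ V′==V)
... | no  _     | _ , ()

cancelsWithin : ℕ → List (ℚ × Pt) → Bool
cancelsWithin _       []             = true
cancelsWithin zero    (_ ∷ _)        = false
cancelsWithin (suc f) ((w , V) ∷ xs) with bothNonpos V | removeFirst (opposite w V) xs
... | true  | _       = cancelsWithin f xs
... | false | just ys = cancelsWithin f ys
... | false | nothing = false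

-- In the formal sum Σ w·[V], every V with a positive coordinate gets total weight 0,
-- the entries cancelling in opposite pairs.  Each round removes an entry, so length xs
-- is enough fuel.
cancels : List (ℚ × Pt) → Bool
cancels xs = cancelsWithin (length xs) xs

weightedSum : (Pt → ℚ) → List (ℚ × Pt) → ℚ
weightedSum F xs = ℚΣ.sum (map (λ (w , V) → w ℚ.* F V) xs)

module _ where
  open import Data.Rational.Solver using (module +-*-Solver)
  open +-*-Solver

  private
    cancel-pair : ∀ (w F r : ℚ) → w ℚ.* F ℚ.+ ((ℚ.- w) ℚ.* F ℚ.+ r) ≡ r
    cancel-pair = solve 3 (λ w F r → w :* F :+ ((:- w) :* F :+ r) := r) refl

  weightedSum-cancels : (F : Pt → ℚ) → (∀ V → T (bothNonpos V) → F V ≡ 0ℚ) →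
                        (f : ℕ) (xs : List (ℚ × Pt)) → T (cancelsWithin f xs) → weightedSum F xs ≡ 0ℚ
  weightedSum-cancels F F-nonpos f       []             _ = refl
  weightedSum-cancels F F-nonpos (suc f) ((w , V) ∷ xs) c
    with bothNonpos V in np | removeFirst (opposite w V) xs in removed
  ... | true | _ = begin
    w ℚ.* F V ℚ.+ weightedSum F xs ≡⟨ cong₂ (λ a b → w ℚ.* a ℚ.+ b) (F-nonpos V (Equivalence.from T-≡ np))
                                           (weightedSum-cancels F F-nonpos f xs c) ⟩
    w ℚ.* 0ℚ ℚ.+ 0ℚ                ≡⟨ trans (ℚP.+-identityʳ _) (ℚP.*-zeroʳ w) ⟩
    0ℚ                              ∎
    where open ≡-Reasoning
  ... | false | just ys
    with (w′ , V′) , opp , split ← ℚΣ.sum-map-removeFirst (λ (w , V) → w ℚ.* F V) (opposite w V) xs ys removed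
    with w′≡-w , V′≡V ← opposite-sound {w} {V} {w′} {V′} opp = begin
    w ℚ.* F V ℚ.+ weightedSum F xs                       ≡⟨ cong (w ℚ.* F V ℚ.+_) split ⟩
    w ℚ.* F V ℚ.+ (w′ ℚ.* F V′ ℚ.+ weightedSum F ys)
      ≡⟨ cong₂ (λ a b → w ℚ.* F V ℚ.+ (a ℚ.* F b ℚ.+ weightedSum F ys)) w′≡-w V′≡V ⟩
    w ℚ.* F V ℚ.+ ((ℚ.- w) ℚ.* F V ℚ.+ weightedSum F ys) ≡⟨ cancel-pair w (F V) _ ⟩
    weightedSum F ys                                     ≡⟨ weightedSum-cancels F F-nonpos f ys c ⟩
    0ℚ                                                   ∎
    where open ≡-Reasoning

smallStep : Pt → Bool
smallStep (s₁ , s₂) = (s₁ ℤ.≤ᵇ 1ℤ) ∧ (s₂ ℤ.≤ᵇ 1ℤ)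

permutesSteps : Model → Subst → Bool
permutesSteps m g = permutes (map (applyMono g) (steps m)) (steps m)

element : Model → Elem → Subst
element m e = evalWord m (Elem.word e)

ε : Elem → ℚ
ε e = sgn (Elem.len e)

δ : Subst → Subst → ℚ
δ h g = ℕtoℚ (indicator (does (h ≟ˢ g)))

identityWeight : Model → ℚ
identityWeight m = ℚΣ.sum (map (λ e → ε e ℚ.* δ idS (element m e)) (nonOmega m))

multiplicity : Model → Elem → ℚ
multiplicity m g = ℚΣ.sum (map (λ h → ε h ℚ.* δ (element m h) (element m g)) (nonOmega m))

normalisation : Model → ℚ
normalisation m = ℚΣ.sum (map (λ g → ε g ℚ.* (invDen m ℚ.* multiplicity m g)) (nonOmega m))

record WeylFacts (m : Model) : Set where
  field
    steps-small     : T (allᵇ smallStep (steps m))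
    steps-invariant : T (allᵇ (permutesSteps m ∘ element m) (nonOmega m))
    images-safe     : T (allᵇ (safe ∘ element m) (nonOmega m))
    images-coincide-or-separate :
      T (allᵇ (λ g → allᵇ (λ h → coincideOrSeparate (element m h) (element m g)) (nonOmega m)) (nonOmega m))
    left-cancels    : T (cancels (map (λ e → ε e , proj₂ (element m e)) (nonOmega m)))
    bottom-cancels  : T (cancels (map (λ e → ε e , proj₁ (element m e)) (nonOmega m)))
    identity-once   : identityWeight m ≡ 1ℚ
    normalised      : normalisation m ≡ 1ℚ

-- Agda fills in the omitted fields: each has type T b for a closed b that evaluates to true.
weylFacts : (m : Model) → WeylFacts m
weylFacts simple           = record { identity-once = refl ; normalised = refl }
weylFacts diagonal         = record { identity-once = refl ; normalised = refl }
weylFacts king             = record { identity-once = refl ; normalised = refl }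
weylFacts diabolo          = record { identity-once = refl ; normalised = refl }
weylFacts tandem           = record { identity-once = refl ; normalised = refl }
weylFacts doubleTandem     = record { identity-once = refl ; normalised = refl }
weylFacts gouyouBeauchamps = record { identity-once = refl ; normalised = refl }

coefHQ-image : (m : Model) (n : ℕ) (h g : Subst) → T (coincideOrSeparate h g) → (i j : ℕ) →
               coefHQ m n h (dot g (+ i , + j)) ≡ δ h g ℚ.* ℕtoℚ (quadrantCount m n (+ i , + j))
coefHQ-image m n h g ok i j = begin
  coefHQ m n h (dot g p)
    ≡⟨ cong ℕtoℚ (countᵇ-cong (walks m n) image-of-walk) ⟩
  ℕtoℚ (countᵇ (λ w → does (h ≟ˢ g) ∧ (quadrantWalk w ∧ (endpoint origin w == p))) (walks m n))
    ≡⟨ cong ℕtoℚ (countᵇ-∧ˡ (does (h ≟ˢ g)) (λ w → quadrantWalk w ∧ (endpoint origin w == p)) (walks m n)) ⟩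
  ℕtoℚ (if does (h ≟ˢ g) then quadrantCount m n p else 0)
    ≡⟨ ℕtoℚ-if (does (h ≟ˢ g)) (quadrantCount m n p) ⟩
  δ h g ℚ.* ℕtoℚ (quadrantCount m n p) ∎
  where
  open ≡-Reasoning
  p : Pt
  p = (+ i , + j)
  image-of-walk : ∀ w → quadrantWalk w ∧ (dot h (endpoint origin w) == dot g p)
                        ≡ does (h ≟ˢ g) ∧ (quadrantWalk w ∧ (endpoint origin w == p))
  image-of-walk w with quadrantWalk w in q-walk
  ... | false = sym (∧-zeroʳ (does (h ≟ˢ g)))
  ... | true with a , b , e ← inQuadrant-ℕ (endpoint origin w) (quadrantWalk-endpoint w q-walk)
    rewrite e = dot-==-dot h g ok a b i j

module _ where
  open import Data.Rational.Solver using (module +-*-Solver)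
  open +-*-Solver

  private
    affine-step : ∀ (s c I k X a b : ℚ) →
      s ℚ.* (c ℚ.- I ℚ.* (k ℚ.* X)) ℚ.+ (a ℚ.- b ℚ.* X) ≡ (s ℚ.* c ℚ.+ a) ℚ.- (s ℚ.* (I ℚ.* k) ℚ.+ b) ℚ.* X
    affine-step = solve 7 (λ s c I k X a b →
      s :* (c :- I :* (k :* X)) :+ (a :- b :* X) := (s :* c :+ a) :- (s :* (I :* k) :+ b) :* X) refl

  sum-map-affine : {A : Set} (s c k : A → ℚ) (I X : ℚ) (xs : List A) →
    ℚΣ.sum (map (λ x → s x ℚ.* (c x ℚ.- I ℚ.* (k x ℚ.* X))) xs)
    ≡ ℚΣ.sum (map (λ x → s x ℚ.* c x) xs) ℚ.- ℚΣ.sum (map (λ x → s x ℚ.* (I ℚ.* k x)) xs) ℚ.* X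
  sum-map-affine s c k I X []       = sym (cong (λ z → 0ℚ ℚ.- z) (ℚP.*-zeroˡ X))
  sum-map-affine s c k I X (x ∷ xs) =
    trans (cong (s x ℚ.* (c x ℚ.- I ℚ.* (k x ℚ.* X)) ℚ.+_) (sum-map-affine s c k I X xs))
          (affine-step (s x) (c x) I (k x) X _ _)

coefP-unfold : (m : Model) (g : Subst) (n i j : ℕ) →
  coefP m g n i j ≡ ℕtoℚ (coneCount m n (dot g (+ i , + j)))
                    ℚ.- invDen m ℚ.* ℚΣ.sum (map (λ h → ε h ℚ.* coefHQ m n (element m h) (dot g (+ i , + j))) (nonOmega m))
coefP-unfold m g n i j = refl

-- The signed sum of cone walks counts quadrant walks, for a fixed model

data Near𝒬 : Pt → Set where
  inside : (k l : ℕ) → Near𝒬 (+ k , + l)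
  left   : (y : ℤ) → -1ℤ ℤ.≤ y → Near𝒬 (-1ℤ , y)
  bottom : (x : ℤ) → -1ℤ ℤ.≤ x → Near𝒬 (x , -1ℤ)

near𝒬 : (x y : ℤ) → -1ℤ ℤ.≤ x → -1ℤ ℤ.≤ y → Near𝒬 (x , y)
near𝒬 (+ k)             (+ l)             _           _           = inside k l
near𝒬 -[1+ 0 ]          y                 _           -1≤y        = left y -1≤y
near𝒬 (+ k)             -[1+ 0 ]          -1≤x        _           = bottom (+ k) -1≤x
near𝒬 -[1+ suc _ ]      _                 (ℤ.-≤- ())  _
near𝒬 (+ _)             -[1+ suc _ ]      _           (ℤ.-≤- ())

near𝒬-⊝ : (i j : ℕ) (s : Pt) → T (smallStep s) → Near𝒬 ((+ i , + j) ⊝ s)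
near𝒬-⊝ i j (s₁ , s₂) s≤1 with Equivalence.to (T-∧ {s₁ ℤ.≤ᵇ 1ℤ}) s≤1
... | s₁≤1 , s₂≤1 = near𝒬 _ _ (-1≤ i (ℤP.≤ᵇ⇒≤ {s₁} {1ℤ} s₁≤1)) (-1≤ j (ℤP.≤ᵇ⇒≤ {s₂} {1ℤ} s₂≤1))
  where
  -1≤ : ∀ k {c} → c ℤ.≤ 1ℤ → -1ℤ ℤ.≤ + k ℤ.+ ℤ.- c
  -1≤ k c≤1 = ℤP.+-mono-≤ (ℤ.+≤+ ℕ.z≤n) (ℤP.neg-mono-≤ c≤1)

module WeylModel (m : Model) (facts : WeylFacts m) where
  open WeylFacts facts
  open ≡-Reasoning

  L : List Elem
  L = nonOmega m

  signedConeSum : ℕ → Pt → ℚ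
  signedConeSum n p = ℚΣ.sum (map (λ e → ε e ℚ.* ℕtoℚ (coneCount m n (dot (element m e) p))) L)

  coincide-or-separate : ∀ {h g} → h ∈ L → g ∈ L → T (coincideOrSeparate (element m h) (element m g))
  coincide-or-separate {h} {g} h∈ g∈ =
    allᵇ-∈ (λ h → coincideOrSeparate (element m h) (element m g))
           (allᵇ-∈ (λ g → allᵇ (λ h → coincideOrSeparate (element m h) (element m g)) L) images-coincide-or-separate g∈) h∈

  coneCount-image-suc : ∀ {e} → e ∈ L → (n i j : ℕ) →
    coneCount m (suc n) (dot (element m e) (+ i , + j))
      ≡ ℕΣ.sum (map (λ s → coneCount m n (dot (element m e) ((+ i , + j) ⊝ s))) (steps m))
  coneCount-image-suc {e} e∈ n i j = begin
    coneCount m (suc n) q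
      ≡⟨ coneCount-suc m n q ⟩
    ℕΣ.sum (map (λ s → if coneStep (q ⊝ s) q then coneCount m n (q ⊝ s) else 0) (steps m))
      ≡⟨ ℕΣ.sum-map-cong (steps m) (λ {s} _ → cong (λ b → if b then coneCount m n (q ⊝ s) else 0)
                                                    (safe-coneStep g (allᵇ-∈ (safe ∘ element m) images-safe e∈) i j (q ⊝ s))) ⟩
    ℕΣ.sum (map (λ s → coneCount m n (q ⊝ s)) (steps m))
      ≡⟨ ℕΣ.sum-map-permutes (λ s → coneCount m n (q ⊝ s)) (map (applyMono g) (steps m)) (steps m)
                             (allᵇ-∈ (permutesSteps m ∘ element m) steps-invariant e∈) ⟨
    ℕΣ.sum (map (λ s → coneCount m n (q ⊝ s)) (map (applyMono g) (steps m)))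
      ≡⟨ cong ℕΣ.sum (map-∘ {g = λ s → coneCount m n (q ⊝ s)} {f = applyMono g} (steps m)) ⟨
    ℕΣ.sum (map (λ s → coneCount m n (q ⊝ applyMono g s)) (steps m))
      ≡⟨ ℕΣ.sum-map-cong (steps m) (λ {s} _ → cong (coneCount m n) (sym (dot-⊝ g (+ i , + j) s))) ⟩
    ℕΣ.sum (map (λ s → coneCount m n (dot g ((+ i , + j) ⊝ s))) (steps m)) ∎
    where
    g : Subst
    g = element m e
    q : Pt
    q = dot g (+ i , + j)

  signedConeSum-suc : (n i j : ℕ) →
    signedConeSum (suc n) (+ i , + j) ≡ ℚΣ.sum (map (λ s → signedConeSum n ((+ i , + j) ⊝ s)) (steps m))
  signedConeSum-suc n i j = begin
    signedConeSum (suc n) p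
      ≡⟨ ℚΣ.sum-map-cong L (λ {e} e∈ → cong (ε e ℚ.*_)
           (trans (cong ℕtoℚ (coneCount-image-suc e∈ n i j))
                  (ℕtoℚ-sum (λ s → coneCount m n (dot (element m e) (p ⊝ s))) (steps m)))) ⟩
    ℚΣ.sum (map (λ e → ε e ℚ.* ℚΣ.sum (map (λ s → C e s) (steps m))) L)
      ≡⟨ ℚΣ.sum-map-cong L (λ {e} _ → ℚΣ.*-sum-map (ε e) (C e) (steps m)) ⟩
    ℚΣ.sum (map (λ e → ℚΣ.sum (map (λ s → ε e ℚ.* C e s) (steps m))) L)
      ≡⟨ ℚΣ.sum-map-comm (λ e s → ε e ℚ.* C e s) L (steps m) ⟩
    ℚΣ.sum (map (λ s → signedConeSum n (p ⊝ s)) (steps m)) ∎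
    where
    p : Pt
    p = (+ i , + j)
    C : Elem → Pt → ℚ
    C e s = ℕtoℚ (coneCount m n (dot (element m e) (p ⊝ s)))

  signedConeSum-line : (col : Subst → Pt) → T (cancels (map (λ e → ε e , col (element m e)) L)) →
    (n : ℕ) (q : Pt) (c : ℤ) → -1ℤ ℤ.≤ c → (∀ g → dot g q ≡ ((c ℤ.+ 1ℤ) ⊛ col g) ⊕ (-1ℤ , -1ℤ)) →
    signedConeSum n q ≡ 0ℚ
  signedConeSum-line col cancel n q c -1≤c dot-q = begin
    signedConeSum n q
      ≡⟨ ℚΣ.sum-map-cong L (λ {e} _ → cong (λ z → ε e ℚ.* ℕtoℚ (coneCount m n z))
           (trans (dot-q (element m e)) (cong (λ k → (k ⊛ col (element m e)) ⊕ (-1ℤ , -1ℤ)) (sym +k≡c+1)))) ⟩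
    ℚΣ.sum (map (λ e → ε e ℚ.* F (col (element m e))) L)
      ≡⟨ cong ℚΣ.sum (map-∘ {g = λ (w , V) → w ℚ.* F V} {f = weighted-column} L) ⟩
    weightedSum F (map weighted-column L)
      ≡⟨ weightedSum-cancels F F-nonpos (length (map weighted-column L)) (map weighted-column L) cancel ⟩
    0ℚ ∎
    where
    weighted-column : Elem → ℚ × Pt
    weighted-column e = ε e , col (element m e)
    k : ℕ
    k = ℤ.∣ c ℤ.+ 1ℤ ∣
    +k≡c+1 : + k ≡ c ℤ.+ 1ℤ
    +k≡c+1 = ℤP.0≤i⇒+∣i∣≡i (ℤP.+-monoˡ-≤ 1ℤ -1≤c)
    F : Pt → ℚ
    F V = ℕtoℚ (coneCount m n (((+ k) ⊛ V) ⊕ (-1ℤ , -1ℤ)))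
    F-nonpos : ∀ V → T (bothNonpos V) → F V ≡ 0ℚ
    F-nonpos V np = cong ℕtoℚ (coneCount-outside m n (scaled-nonpos-outside k V np))

  signedConeSum-zero : (i j : ℕ) → signedConeSum 0 (+ i , + j) ≡ ℕtoℚ (quadrantCount m 0 (+ i , + j))
  signedConeSum-zero i j = begin
    signedConeSum 0 p
      ≡⟨ ℚΣ.sum-map-cong L (λ {e} e∈ → cong (λ c → ε e ℚ.* ℕtoℚ c) (trans (coneCount-zero m (dot (element m e) p))
           (cong indicator (dot-==-dot idS (element m e) (coincide-or-separate (here refl) e∈) 0 0 i j)))) ⟩
    ℚΣ.sum (map (λ e → ε e ℚ.* ℕtoℚ (indicator (does (idS ≟ˢ element m e) ∧ (origin == p)))) L)
      ≡⟨ at-origin (origin == p) ⟩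
    ℕtoℚ (indicator (origin == p))
      ≡⟨ cong ℕtoℚ (quadrantCount-zero m p) ⟨
    ℕtoℚ (quadrantCount m 0 p) ∎
    where
    p : Pt
    p = (+ i , + j)
    at-origin : (b : Bool) →
      ℚΣ.sum (map (λ e → ε e ℚ.* ℕtoℚ (indicator (does (idS ≟ˢ element m e) ∧ b))) L) ≡ ℕtoℚ (indicator b)
    at-origin true  = trans (ℚΣ.sum-map-cong L (λ {e} _ →
                              cong (λ b → ε e ℚ.* ℕtoℚ (indicator b)) (∧-identityʳ (does (idS ≟ˢ element m e)))))
                            identity-once
    at-origin false = trans (ℚΣ.sum-map-cong L (λ {e} _ →
                              trans (cong (λ b → ε e ℚ.* ℕtoℚ (indicator b)) (∧-zeroʳ (does (idS ≟ˢ element m e))))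
                                    (ℚP.*-zeroʳ (ε e))))
                            (ℚΣ.sum-map-zero L)

  signedConeSum≡quadrantCount : (n i j : ℕ) → signedConeSum n (+ i , + j) ≡ ℕtoℚ (quadrantCount m n (+ i , + j))
  agrees-near𝒬 : (n : ℕ) {q : Pt} → Near𝒬 q → signedConeSum n q ≡ ℕtoℚ (quadrantCount m n q)

  signedConeSum≡quadrantCount zero    i j = signedConeSum-zero i j
  signedConeSum≡quadrantCount (suc n) i j = begin
    signedConeSum (suc n) p
      ≡⟨ signedConeSum-suc n i j ⟩
    ℚΣ.sum (map (λ s → signedConeSum n (p ⊝ s)) (steps m))
      ≡⟨ ℚΣ.sum-map-cong (steps m) (λ {s} s∈ →
           agrees-near𝒬 n {p ⊝ s} (near𝒬-⊝ i j s (allᵇ-∈ smallStep steps-small s∈))) ⟩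
    ℚΣ.sum (map (λ s → ℕtoℚ (quadrantCount m n (p ⊝ s))) (steps m))
      ≡⟨ ℕtoℚ-sum (λ s → quadrantCount m n (p ⊝ s)) (steps m) ⟨
    ℕtoℚ (ℕΣ.sum (map (λ s → quadrantCount m n (p ⊝ s)) (steps m)))
      ≡⟨ cong ℕtoℚ (quadrantCount-suc m n p) ⟨
    ℕtoℚ (quadrantCount m (suc n) p) ∎
    where
    p : Pt
    p = (+ i , + j)

  agrees-near𝒬 n (inside k l)   = signedConeSum≡quadrantCount n k l
  agrees-near𝒬 n (left y -1≤y)  =
    trans (signedConeSum-line proj₂ left-cancels n (-1ℤ , y) y -1≤y (λ g → dot-left g y))
          (cong ℕtoℚ (sym (quadrantCount-outside m n refl)))
  agrees-near𝒬 n (bottom x -1≤x) =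
    trans (signedConeSum-line proj₁ bottom-cancels n (x , -1ℤ) x -1≤x (λ g → dot-bottom g x))
          (cong ℕtoℚ (sym (quadrantCount-outside m n (∧-zeroʳ (0ℤ ℤ.≤ᵇ x)))))

  correction-on-image : (n i j : ℕ) {g : Elem} → g ∈ L →
    ℚΣ.sum (map (λ h → ε h ℚ.* coefHQ m n (element m h) (dot (element m g) (+ i , + j))) L)
      ≡ multiplicity m g ℚ.* ℕtoℚ (quadrantCount m n (+ i , + j))
  correction-on-image n i j {g} g∈ = begin
    ℚΣ.sum (map (λ h → ε h ℚ.* coefHQ m n (element m h) (dot (element m g) (+ i , + j))) L)
      ≡⟨ ℚΣ.sum-map-cong L (λ {h} h∈ → trans
           (cong (ε h ℚ.*_) (coefHQ-image m n (element m h) (element m g) (coincide-or-separate {h} {g} h∈ g∈) i j))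
           (sym (ℚP.*-assoc (ε h) (δ (element m h) (element m g)) Q))) ⟩
    ℚΣ.sum (map (λ h → ε h ℚ.* δ (element m h) (element m g) ℚ.* Q) L)
      ≡⟨ ℚΣ.sum-map-*ʳ (λ h → ε h ℚ.* δ (element m h) (element m g)) Q L ⟩
    multiplicity m g ℚ.* Q ∎
    where
    Q : ℚ
    Q = ℕtoℚ (quadrantCount m n (+ i , + j))

  coefP-image : (n i j : ℕ) {g : Elem} → g ∈ L →
    coefP m (element m g) n i j
      ≡ ℕtoℚ (coneCount m n (dot (element m g) (+ i , + j)))
        ℚ.- invDen m ℚ.* (multiplicity m g ℚ.* ℕtoℚ (quadrantCount m n (+ i , + j)))
  coefP-image n i j {g} g∈ = trans (coefP-unfold m (element m g) n i j)
    (cong (λ z → ℕtoℚ (coneCount m n (dot (element m g) (+ i , + j))) ℚ.- invDen m ℚ.* z)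
          (correction-on-image n i j {g} g∈))

corollary16 : (m : Model) (n i j : ℕ) → coefSumP m n i j ≡ 0ℚ
corollary16 m n i j = begin
  coefSumP m n i j
    ≡⟨ ℚΣ.sum-map-cong L (λ {g} g∈ → cong (ε g ℚ.*_) (coefP-image n i j {g} g∈)) ⟩
  ℚΣ.sum (map (λ g → ε g ℚ.* (C g ℚ.- invDen m ℚ.* (multiplicity m g ℚ.* Q))) L)
    ≡⟨ sum-map-affine ε C (multiplicity m) (invDen m) Q L ⟩
  signedConeSum n (+ i , + j) ℚ.- normalisation m ℚ.* Q
    ≡⟨ cong₂ (λ a b → a ℚ.- b ℚ.* Q) (signedConeSum≡quadrantCount n i j) normalised ⟩
  Q ℚ.- 1ℚ ℚ.* Q
    ≡⟨ trans (cong (λ z → Q ℚ.- z) (ℚP.*-identityˡ Q)) (ℚP.+-inverseʳ Q) ⟩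
  0ℚ ∎
  where
  open ≡-Reasoning
  open WeylModel m (weylFacts m)
  open WeylFacts (weylFacts m) using (normalised)
  Q : ℚ
  Q = ℕtoℚ (quadrantCount m n (+ i , + j))
  C : Elem → ℚ
  C g = ℕtoℚ (coneCount m n (dot (element m g) (+ i , + j)))
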